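{- Consider the multi-tree model below with a configuration $E$ satisfying (A1), (A5) and (A6) (with constant $c$). If $\mathrm{Single}(u,v)$ and $\mathrm{MixSwap}(u,v)$ both return false for all $u,v\in V$, then for each $i\in\mathcal R$ the depth $\max_{w\in V_i}L_i(w)$ of the tree $(V_i,E_i)$ is at most $\log_2(N+1)+c$.
   Context: Model: $V=\{1,\dots,N\}$ is a set of nodes (integer ids), $\mathcal R=\{1,\dots,M\}\subseteq V$ a set of roots (colors), $K$ an integer with $1\le K\le M$. $E$ is a set of directed links between nodes of $V$, each colored by exactly one $i\in\mathcal R$; $E_i$ = links of color $i$ ("$i$-links"). Each root $i$ is regarded as always having an incoming $i$-link from an external server (not in $E$). Node $u$ has outdegree capacity $\bar d_u\in\mathbb Z_{\ge0}$. $L_i(u)$ = minimum number of hops of a directed path from $i$ to $u$ in $(V,E_i)$ ($L_i(i)=0$, $+\infty$ if none); $V_i=\{u:L_i(u)<\infty\}$. $d_i(u)$ = number of outgoing $i$-links of $u$, $d(u)=\sum_i d_i(u)$. $u$ is an $i$-parent of $w$, $w$ an $i$-child of $u$, if $(u,w)\in E_i$. Assumptions: (A1) every node has at most $K$ incoming links, at most one incoming $i$-link for each $i$, and at most $\bar d_u$ outgoing links. (A5) $\bar d_u\ne 1$ for all $u\in V\setminus\mathcal R$. (A6) there is a positive integer $c$ such that for each $i\in\mathcal R$, with $\hat V_i=\{u\in V_i: L_i(u)\le c\}$, the subgraph $(\hat V_i,E_i)$ has at least $M$ leaves (nodes of $\hat V_i$ with no outgoing $i$-link into $\hat V_i$).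 Procedure $\mathrm{Single}(u,v)$ (exact depths): if there is $i$ such that $u$ and $v$ both have an incoming $i$-link, then (Jump) if $d(v)<\bar d_v$ and $L_i(v)+1<L_i(u)$, remove the incoming $i$-link $(u_p,u)$ of $u$, add $(v,u)$ to $E_i$, return true; (LeafSwap) else if $d_i(v)=0$, $d_i(u)\ge1$ and $L_i(u)>L_i(v)$, with $u_p,v_p$ the $i$-parents of $u,v$, remove $(u_p,u),(v_p,v)$, add $(u_p,v),(v_p,u)$ to $E_i$, return true. Otherwise return false. Procedure $\mathrm{MixSwap}(u_c,v)$ (exact depths): if there exist $i\ne j$ in $\mathcal R$, a $j$-child $v_c$ of $v$ and an $i$-parent $u$ of $u_c$ with $L_i(u)\ge L_i(v)$, $L_j(u)\le L_j(v)$, and either (a) $L_i(u)\ne L_i(v)$ or $L_j(u)\ne L_j(v)$, or (b) $L_i(u)=L_i(v)$, $L_j(u)=L_j(v)$, $(u-v)(j-i)>0$, then remove $(u,u_c),(v,v_c)$, add $(u,v_c)$ to $E_j$ and $(v,u_c)$ to $E_i$, return true. Otherwise return false. Ties are broken arbitrarily. -}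

module Defs where

open import Data.Nat using (ℕ; zero; suc; _+_; _≤_; _<_)
open import Data.Fin using (Fin; toℕ; inject≤)
import Data.Fin as F
open import Data.Bool using (Bool; true; false; if_then_else_)
open import Data.Product using (Σ; ∃; _×_; _,_)
open import Data.Sum using (_⊎_)
open import Data.Empty using (⊥)
open import Relation.Nullary using (¬_)
open import Relation.Binary.PropositionalEquality using (_≡_; _≢_)
open import Function.Definitions using (Injective)

data ℕ∞ : Set where
  fin : ℕ → ℕ∞
  ∞   : ℕ∞

_<∞_ : ℕ∞ → ℕ∞ → Set
fin a <∞ fin b = a < b
fin a <∞ ∞     = Data.Unit.⊤ where import Data.Unit
∞     <∞ _     = ⊥

_≤∞_ : ℕ∞ → ℕ∞ → Set
fin a ≤∞ fin b = a ≤ b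
_     ≤∞ ∞     = Data.Unit.⊤ where import Data.Unit
∞     ≤∞ fin _ = ⊥

suc∞ : ℕ∞ → ℕ∞
suc∞ (fin a) = fin (suc a)
suc∞ ∞       = ∞

countB : {n : ℕ} → (Fin n → Bool) → ℕ
countB {zero}  f = 0
countB {suc n} f = (if f F.zero then 1 else 0) + countB (λ x → f (F.suc x))

sumF : {n : ℕ} → (Fin n → ℕ) → ℕ
sumF {zero}  f = 0
sumF {suc n} f = f F.zero + sumF (λ x → f (F.suc x))

-- Nodes: Fin N (node ids 1..N shifted to 0..N-1, order preserved).
-- Roots/colours: Fin M, with M ≤ N; colour i is the node  root i.
-- A configuration E : Fin M → Fin N → Fin N → Bool;
--   E i u w ≡ true  means  (u,w) ∈ E_i  (an i-link from u to w).

Config : ℕ → ℕ → Set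
Config M N = Fin M → Fin N → Fin N → Bool

module Model {M N : ℕ} (M≤N : M ≤ N) (E : Config M N) where

  root : Fin M → Fin N
  root i = inject≤ i M≤N

  IsRoot : Fin N → Set
  IsRoot u = ∃ λ i → u ≡ root i

  dcol : Fin M → Fin N → ℕ
  dcol i u = countB (λ w → E i u w)

  d : Fin N → ℕ
  d u = sumF (λ i → dcol i u)

  -- incoming i-links of u, counting the external server link into root i
  indegCol : Fin M → Fin N → ℕ
  indegCol i u = (if isRootOf i u then 1 else 0) + countB (λ w → E i w u)
    where
    isRootOf : Fin M → Fin N → Bool
    isRootOf i u = Relation.Nullary.Decidable.Core.isYes (u F.≟ root i)
      where import Relation.Nullary.Decidable.Core

  indeg : Fin N → ℕ
  indeg u = sumF (λ i → indegCol i u)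

  HasIn : Fin M → Fin N → Set
  HasIn i u = (u ≡ root i) ⊎ (∃ λ w → E i w u ≡ true)

  data Walk (i : Fin M) : Fin N → ℕ → Set where
    here : Walk i (root i) 0
    step : ∀ {w x k} → Walk i w k → E i w x ≡ true → Walk i x (suc k)

  IsDepth : Fin M → Fin N → ℕ∞ → Set
  IsDepth i u (fin k) = Walk i u k × (∀ k′ → k′ < k → ¬ Walk i u k′)
  IsDepth i u ∞       = ∀ k → ¬ Walk i u k

  A1 : (K : ℕ) (dbar : Fin N → ℕ) → Set
  A1 K dbar = (∀ u → indeg u ≤ K)
            × (∀ i u → indegCol i u ≤ 1)
            × (∀ u → d u ≤ dbar u)

  A5 : (dbar : Fin N → ℕ) → Set
  A5 dbar = ∀ u → ¬ IsRoot u → dbar u ≢ 1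

  module WithDepth (L : Fin M → Fin N → ℕ∞) where

    InHat : ℕ → Fin M → Fin N → Set
    InHat c i u = L i u ≤∞ fin c

    HatLeaf : ℕ → Fin M → Fin N → Set
    HatLeaf c i u = InHat c i u × (∀ w → E i u w ≡ true → ¬ InHat c i w)

    A6 : ℕ → Set
    A6 c = ∀ i → Σ (Fin M → Fin N) λ f →
             Injective _≡_ _≡_ f × (∀ m → HatLeaf c i (f m))

    JumpCond : (dbar : Fin N → ℕ) → Fin M → Fin N → Fin N → Set
    JumpCond dbar i u v = d v < dbar v × suc∞ (L i v) <∞ L i u

    LeafSwapCond : Fin M → Fin N → Fin N → Set
    LeafSwapCond i u v = dcol i v ≡ 0 × 1 ≤ dcol i u × L i v <∞ L i u

    SingleTrue : (dbar : Fin N → ℕ) → Fin N → Fin N → Set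
    SingleTrue dbar u v = ∃ λ i → HasIn i u × HasIn i v
                          × (JumpCond dbar i u v ⊎ LeafSwapCond i u v)

    MixSwapTrue : Fin N → Fin N → Set
    MixSwapTrue uc v =
      ∃ λ i → ∃ λ j → ∃ λ vc → ∃ λ u →
        i ≢ j × E j v vc ≡ true × E i u uc ≡ true
        × L i v ≤∞ L i u × L j u ≤∞ L j v
        × ( (L i u ≢ L i v ⊎ L j u ≢ L j v)
          ⊎ (L i u ≡ L i v × L j u ≡ L j v
             × ((toℕ u < toℕ v × toℕ j < toℕ i)
               ⊎ (toℕ v < toℕ u × toℕ i < toℕ j))) )

-- Fix a colour i and a node w of i-depth k = D + 1 > c.  Stability gives, at
-- every depth ℓ < D of the i-tree: each node has an i-child (no LeafSwap with
-- the parent of w) and no spare capacity (no Jump of w); if moreover c ≤ ℓ, a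
-- node with a single i-child also has a child of another colour (by (A5)), and
-- for each colour j ≠ i at most one node of depth ℓ has both an i-child and a
-- j-child (no MixSwap).  Counting the i-links that leave depth ℓ, the level
-- sizes n_ℓ of the i-tree therefore satisfy
--   n_c ≥ M  (the leaves given by (A6))   and   2 n_ℓ ≤ n_(ℓ+1) + (M − 1)  (c ≤ ℓ < D),
-- so n_(c+t) ≥ 2^t + M − 1 and n_c + … + n_D ≥ 2^(k−c) − 1; as the levels are
-- disjoint, this sum is at most N.

module Submission where

open import Defs
open import Data.Nat using (ℕ; suc; _≤_; _^_; _∸_; _+_)
open import Data.Fin using (Fin)
open import Relation.Nullary using (¬_)
open import Relation.Binary.PropositionalEquality using (_≡_)

open import Data.Nat using (zero; _*_; _<_; z≤n; s≤s; _≟_; _≤?_; _<?_)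
open import Data.Nat.Properties
open import Data.Nat.Tactic.RingSolver using (solve-∀)
open import Data.Fin using (toℕ)
import Data.Fin as F
import Data.Fin.Properties as FP
open import Data.Bool using (Bool; true; false; if_then_else_; _∧_)
open import Data.Product using (∃; _×_; _,_; proj₁; proj₂)
open import Data.Sum using (_⊎_; inj₁; inj₂)
open import Data.Unit using (tt)
open import Data.Empty using (⊥; ⊥-elim)
open import Function using (_∘_)
open import Relation.Nullary using (Dec; yes; no; does; _because_; ¬?; _×-dec_; contradiction)
open import Relation.Nullary.Reflects using (invert)
open import Relation.Nullary.Decidable using (dec-true; map′)
open import Relation.Binary.Definitions using (DecidableEquality; tri<; tri≈; tri>)
open import Relation.Binary.PropositionalEquality using (_≢_; refl; sym; trans; cong; cong₂; subst; subst₂)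

does-sound : ∀ {p} {P : Set p} (a? : Dec P) → does a? ≡ true → P
does-sound (true because [p]) _ = invert [p]
does-sound (false because _) ()

ind : Bool → ℕ
ind b = if b then 1 else 0

ind≤1 : ∀ b → ind b ≤ 1
ind≤1 true = s≤s z≤n
ind≤1 false = z≤n

sumF-ext : ∀ {n} {f g : Fin n → ℕ} → (∀ x → f x ≡ g x) → sumF f ≡ sumF g
sumF-ext {zero} h = refl
sumF-ext {suc n} h = cong₂ _+_ (h F.zero) (sumF-ext (h ∘ F.suc))

sumF-mono : ∀ {n} {f g : Fin n → ℕ} → (∀ x → f x ≤ g x) → sumF f ≤ sumF g
sumF-mono {zero} h = z≤n
sumF-mono {suc n} h = +-mono-≤ (h F.zero) (sumF-mono (h ∘ F.suc))

sumF-+ : ∀ {n} (f g : Fin n → ℕ) → sumF (λ x → f x + g x) ≡ sumF f + sumF g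
sumF-+ {zero} f g = refl
sumF-+ {suc n} f g =
  trans (cong (f F.zero + g F.zero +_) (sumF-+ (f ∘ F.suc) (g ∘ F.suc)))
        (+-+-interchange (f F.zero) (g F.zero) _ _)
  where
  +-+-interchange : ∀ a b c d → (a + b) + (c + d) ≡ (a + c) + (b + d)
  +-+-interchange = solve-∀

sumF-const : ∀ {n} k → sumF {n} (λ _ → k) ≡ n * k
sumF-const {zero} k = refl
sumF-const {suc n} k = cong (k +_) (sumF-const {n} k)

sumF-swap : ∀ {m n} (f : Fin m → Fin n → ℕ) →
  sumF (λ a → sumF (f a)) ≡ sumF (λ b → sumF (λ a → f a b))
sumF-swap {zero} {n} f = sym (trans (sumF-const {n} 0) (*-zeroʳ n))
sumF-swap {suc m} f =
  trans (cong (sumF (f F.zero) +_) (sumF-swap (f ∘ F.suc)))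
        (sym (sumF-+ (f F.zero) (λ b → sumF (λ a → f (F.suc a) b))))

sumF-single : ∀ {n} (f : Fin n → ℕ) a → f a ≤ sumF f
sumF-single f F.zero = m≤m+n _ _
sumF-single f (F.suc a) = ≤-trans (sumF-single (f ∘ F.suc) a) (m≤n+m _ _)

sumF-two : ∀ {n} (f : Fin n → ℕ) a b → a ≢ b → f a + f b ≤ sumF f
sumF-two f F.zero F.zero a≢b = contradiction refl a≢b
sumF-two f F.zero (F.suc b) _ = +-monoʳ-≤ (f F.zero) (sumF-single (f ∘ F.suc) b)
sumF-two f (F.suc a) F.zero _ =
  subst (_≤ sumF f) (+-comm (f F.zero) (f (F.suc a)))
        (+-monoʳ-≤ (f F.zero) (sumF-single (f ∘ F.suc) a))
sumF-two f (F.suc a) (F.suc b) a≢b =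
  ≤-trans (sumF-two (f ∘ F.suc) a b (a≢b ∘ cong F.suc)) (m≤n+m _ _)

sumF-positive : ∀ {n} (f : Fin n → ℕ) → 1 ≤ sumF f → ∃ λ a → 1 ≤ f a
sumF-positive {suc n} f h with f F.zero in eq
... | suc _ = F.zero , subst (1 ≤_) (sym eq) (s≤s z≤n)
... | zero with sumF-positive (f ∘ F.suc) h
...   | a , p = F.suc a , p

sumF-exceeds : ∀ {n} (f : Fin n → ℕ) a → f a < sumF f → ∃ λ b → b ≢ a × 1 ≤ f b
sumF-exceeds f F.zero h
  with sumF-positive (f ∘ F.suc) (+-cancelˡ-≤ (f F.zero) 1 _ (subst (_≤ sumF f) (+-comm 1 (f F.zero)) h))
... | b , p = F.suc b , (λ ()) , p
sumF-exceeds f (F.suc a) h with f F.zero in eq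
... | suc _ = F.zero , (λ ()) , subst (1 ≤_) (sym eq) (s≤s z≤n)
... | zero with sumF-exceeds (f ∘ F.suc) a h
...   | b , b≢a , p = F.suc b , b≢a ∘ FP.suc-injective , p

countB-sum : ∀ {n} (f : Fin n → Bool) → countB f ≡ sumF (ind ∘ f)
countB-sum {zero} f = refl
countB-sum {suc n} f = cong (ind (f F.zero) +_) (countB-sum (f ∘ F.suc))

countB-all : ∀ {n} → countB {n} (λ _ → true) ≡ n
countB-all {zero} = refl
countB-all {suc n} = cong suc (countB-all {n})

countB-true : ∀ {n} (f : Fin n → Bool) a → f a ≡ true → 1 ≤ countB f
countB-true f a fa = subst (1 ≤_) (sym (countB-sum f))
  (≤-trans (subst (λ b → 1 ≤ ind b) (sym fa) ≤-refl) (sumF-single (ind ∘ f) a))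

countB-two : ∀ {n} (f : Fin n → Bool) a b → f a ≡ true → f b ≡ true → a ≢ b →
  2 ≤ countB f
countB-two f a b fa fb a≢b = subst (2 ≤_) (sym (countB-sum f))
  (≤-trans (subst₂ (λ x y → 2 ≤ ind x + ind y) (sym fa) (sym fb) ≤-refl)
           (sumF-two (ind ∘ f) a b a≢b))

countB-witness : ∀ {n} (f : Fin n → Bool) → 1 ≤ countB f → ∃ λ a → f a ≡ true
countB-witness f h with sumF-positive (ind ∘ f) (subst (1 ≤_) (countB-sum f) h)
... | a , p = a , ind-positive (f a) p
  where
  ind-positive : ∀ b → 1 ≤ ind b → b ≡ true
  ind-positive true _ = refl

countB-none : ∀ {n} (f : Fin n → Bool) → (∀ x → f x ≢ true) → countB f ≡ 0
countB-none {zero} f h = refl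
countB-none {suc n} f h with f F.zero in eq
... | true = contradiction eq (h F.zero)
... | false = countB-none (f ∘ F.suc) (h ∘ F.suc)

countB-atMostOnce : ∀ {n} (f : Fin n → Bool) (b : Bool) →
  (∀ x → f x ≡ true → b ≡ true) → (∀ x y → f x ≡ true → f y ≡ true → x ≡ y) →
  countB f ≤ ind b
countB-atMostOnce f false imp uniq =
  ≤-reflexive (countB-none f (λ x fx → case-false (imp x fx)))
  where
  case-false : false ≢ true
  case-false ()
countB-atMostOnce {zero} f true imp uniq = z≤n
countB-atMostOnce {suc n} f true imp uniq with f F.zero in eq
... | true = ≤-reflexive (cong suc (countB-none (f ∘ F.suc) (λ x fx → zero≢suc (uniq F.zero (F.suc x) eq fx))))
  where
  zero≢suc : ∀ {x : Fin n} → F.zero ≢ F.suc x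
  zero≢suc ()
... | false = countB-atMostOnce (f ∘ F.suc) true (λ _ _ → refl)
                (λ x y fx fy → FP.suc-injective (uniq (F.suc x) (F.suc y) fx fy))

count-relation : ∀ {m n} (R : Fin m → Fin n → Bool) (Q : Fin n → Bool) →
  (∀ x y → R x y ≡ true → Q y ≡ true) →
  (∀ x x′ y → R x y ≡ true → R x′ y ≡ true → x ≡ x′) →
  sumF (λ x → countB (R x)) ≤ countB Q
count-relation R Q toQ uniq = begin
  sumF (λ x → countB (R x))               ≡⟨ sumF-ext (λ x → countB-sum (R x)) ⟩
  sumF (λ x → sumF (λ y → ind (R x y)))   ≡⟨ sumF-swap (λ x y → ind (R x y)) ⟩
  sumF (λ y → sumF (λ x → ind (R x y)))   ≤⟨ sumF-mono column ⟩
  sumF (ind ∘ Q)                          ≡⟨ countB-sum Q ⟨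
  countB Q                                ∎
  where
  open ≤-Reasoning
  column : ∀ y → sumF (λ x → ind (R x y)) ≤ ind (Q y)
  column y = subst (_≤ ind (Q y)) (countB-sum (λ x → R x y))
    (countB-atMostOnce (λ x → R x y) (Q y) (λ x r → toQ x y r) (λ x x′ r r′ → uniq x x′ y r r′))

count-injection : ∀ {m n} (P : Fin m → Bool) (Q : Fin n → Bool) (R : Fin m → Fin n → Bool) →
  (∀ x → P x ≡ true → ∃ λ y → R x y ≡ true) →
  (∀ x y → R x y ≡ true → Q y ≡ true) →
  (∀ x x′ y → R x y ≡ true → R x′ y ≡ true → x ≡ x′) →
  countB P ≤ countB Q
count-injection P Q R total toQ uniq = begin
  countB P                    ≡⟨ countB-sum P ⟩
  sumF (ind ∘ P)              ≤⟨ sumF-mono row ⟩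
  sumF (λ x → countB (R x))   ≤⟨ count-relation R Q toQ uniq ⟩
  countB Q                    ∎
  where
  open ≤-Reasoning
  row : ∀ x → ind (P x) ≤ countB (R x)
  row x with P x in px
  ... | false = z≤n
  ... | true with total x px
  ...   | y , r = countB-true (R x) y r

count-others : ∀ {n} (i : Fin n) → suc (countB (λ j → does (¬? (j F.≟ i)))) ≡ n
count-others {suc n} F.zero = cong suc countB-all
count-others {suc (suc n)} (F.suc i) = cong suc (count-others i)

fin-injective : ∀ {a b} → fin a ≡ fin b → a ≡ b
fin-injective refl = refl

_≟∞_ : DecidableEquality ℕ∞
fin a ≟∞ fin b = map′ (cong fin) fin-injective (a ≟ b)
fin _ ≟∞ ∞     = no (λ ())
∞     ≟∞ fin _ = no (λ ())
∞     ≟∞ ∞     = yes refl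

atLevel : ∀ {n} → (Fin n → ℕ∞) → ℕ → Fin n → Bool
atLevel h ℓ x = does (h x ≟∞ fin ℓ)

≤∞-reflexive : ∀ {a b} → a ≡ b → a ≤∞ b
≤∞-reflexive {fin a} refl = ≤-refl
≤∞-reflexive {∞} refl = tt

≤∞-total : ∀ a b → a ≤∞ b ⊎ b ≤∞ a
≤∞-total (fin a) (fin b) = ≤-total a b
≤∞-total (fin _) ∞ = inj₁ tt
≤∞-total ∞ (fin _) = inj₂ tt
≤∞-total ∞ ∞ = inj₁ tt

sumBelow : (ℕ → ℕ) → ℕ → ℕ
sumBelow g zero = 0
sumBelow g (suc t) = sumBelow g t + g t

sumBelow-sumF : ∀ {n} (P : ℕ → Fin n → Bool) t →
  sumBelow (λ s → countB (P s)) t ≡ sumF (λ x → sumBelow (λ s → ind (P s x)) t)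
sumBelow-sumF {n} P zero = sym (trans (sumF-const {n} 0) (*-zeroʳ n))
sumBelow-sumF P (suc t) =
  trans (cong₂ _+_ (sumBelow-sumF P t) (countB-sum (P t)))
        (sym (sumF-+ (λ x → sumBelow (λ s → ind (P s x)) t) (λ x → ind (P t x))))

-- A sequence of booleans true at most once has indicator sum at most 1
-- (stated with a later index `u` to make the induction go through).
sumBelow-exclusive : (b : ℕ → Bool) → (∀ s s′ → b s ≡ true → b s′ ≡ true → s ≡ s′) →
  ∀ t u → t ≤ u → sumBelow (ind ∘ b) t + ind (b u) ≤ 1
sumBelow-exclusive b excl zero u _ = ind≤1 (b u)
sumBelow-exclusive b excl (suc t) u t<u
  with b u in bu | sumBelow-exclusive b excl t u (<⇒≤ t<u)
... | false | _ = subst (_≤ 1) (sym (+-identityʳ _)) (sumBelow-exclusive b excl t t ≤-refl)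
... | true | below with b t in bt
...   | true = contradiction (excl t u bt bu) (<⇒≢ t<u)
...   | false = subst (_≤ 1) (cong (_+ 1) (sym (+-identityʳ _))) below

-- Distinct levels are disjoint, so consecutive level sizes sum to at most `n`.
levels-disjoint : ∀ {n} (h : Fin n → ℕ∞) c t →
  sumBelow (λ s → countB (atLevel h (c + s))) t ≤ n
levels-disjoint {n} h c t = begin
  sumBelow (λ s → countB (atLevel h (c + s))) t             ≡⟨ sumBelow-sumF (λ s → atLevel h (c + s)) t ⟩
  sumF (λ x → sumBelow (λ s → ind (atLevel h (c + s) x)) t) ≤⟨ sumF-mono at-most-one ⟩
  sumF {n} (λ _ → 1)                                        ≡⟨ trans (sumF-const {n} 1) (*-identityʳ n) ⟩
  n                                                         ∎
  where
  open ≤-Reasoning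
  same-level : ∀ x s s′ → atLevel h (c + s) x ≡ true → atLevel h (c + s′) x ≡ true → s ≡ s′
  same-level x s s′ e e′ = +-cancelˡ-≡ c s s′
    (fin-injective (trans (sym (does-sound (h x ≟∞ _) e)) (does-sound (h x ≟∞ _) e′)))
  at-most-one : ∀ x → sumBelow (λ s → ind (atLevel h (c + s) x)) t ≤ 1
  at-most-one x = ≤-trans (m≤m+n _ _)
    (sumBelow-exclusive (λ s → atLevel h (c + s) x) (same-level x) t t ≤-refl)

module Doubling (g : ℕ → ℕ) (m T : ℕ) (start : suc m ≤ g 0)
                (grow : ∀ t → t < T → 2 * g t ≤ g (suc t) + m) where

  level-growth : ∀ t → t ≤ T → 2 ^ t + m ≤ g t
  level-growth zero _ = start
  level-growth (suc t) t<T = +-cancelʳ-≤ m _ _ (begin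
    2 ^ suc t + m + m ≡⟨ double (2 ^ t) m ⟩
    2 * (2 ^ t + m)   ≤⟨ *-monoʳ-≤ 2 (level-growth t (<⇒≤ t<T)) ⟩
    2 * g t           ≤⟨ grow t t<T ⟩
    g (suc t) + m     ∎)
    where
    open ≤-Reasoning
    double : ∀ p m → 2 * p + m + m ≡ 2 * (p + m)
    double = solve-∀

  -- Partial sums: `g 0 + … + g t ≥ 2 ^ (t + 1) − 1`, using `g (t + 1) ≥ 2 ^ (t + 1)`.
  total-growth : ∀ t → t ≤ T → 2 ^ suc t ≤ suc (sumBelow g (suc t))
  total-growth zero _ = s≤s (≤-trans (s≤s z≤n) start)
  total-growth (suc t) t<T = begin
    2 ^ suc (suc t)                    ≡⟨ cong (2 ^ suc t +_) (+-identityʳ (2 ^ suc t)) ⟩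
    2 ^ suc t + 2 ^ suc t              ≤⟨ +-mono-≤ (total-growth t (<⇒≤ t<T)) (≤-trans (m≤m+n _ m) (level-growth (suc t) t<T)) ⟩
    suc (sumBelow g (suc t)) + g (suc t) ∎
    where open ≤-Reasoning

-- Tree structure of a colour class: with at most one incoming i-link per node
-- (part of (A1)) and `L` the exact depths, every link goes exactly one level down.
module Depths {M N : ℕ} (M≤N : M ≤ N) (E : Config M N) (L : Fin M → Fin N → ℕ∞)
              (isDepth : ∀ i u → Model.IsDepth M≤N E i u (L i u))
              (oneParent : ∀ i u → Model.indegCol M≤N E i u ≤ 1) where

  open Model M≤N E

  -- The root's server link counts towards its in-degree, so no i-link enters root i.
  noLinkIntoRoot : ∀ i x → E i x (root i) ≢ true
  noLinkIntoRoot i x e with root i F.≟ root i | oneParent i (root i)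
  ... | yes _ | ≤1 = 1+n≰n (≤-trans (s≤s (countB-true (λ w → E i w (root i)) x e)) ≤1)
  ... | no ≢ | _ = ≢ refl

  parentUnique : ∀ i x x′ y → E i x y ≡ true → E i x′ y ≡ true → x ≡ x′
  parentUnique i x x′ y e e′ with x F.≟ x′
  ... | yes x≡x′ = x≡x′
  ... | no x≢x′ = contradiction
        (≤-trans (countB-two (λ w → E i w y) x x′ e e′ x≢x′) (m≤n+m _ _))
        (λ 2≤ → 1+n≰n (≤-trans 2≤ (oneParent i y)))

  walk : ∀ {i u ℓ} → L i u ≡ fin ℓ → Walk i u ℓ
  walk {i} {u} eq with L i u | isDepth i u
  walk refl | fin _ | w , _ = w

  walk-minimal : ∀ {i u ℓ k} → L i u ≡ fin ℓ → Walk i u k → ℓ ≤ k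
  walk-minimal {i} {u} {ℓ} {k} eq wk with L i u | isDepth i u
  walk-minimal {i} {u} {ℓ} {k} refl wk | fin _ | _ , shortest with ℓ ≤? k
  ... | yes ℓ≤k = ℓ≤k
  ... | no ℓ≰k = contradiction wk (shortest _ (≰⇒> ℓ≰k))

  walk-finite : ∀ {i u k} → Walk i u k → ∃ λ ℓ → L i u ≡ fin ℓ
  walk-finite {i} {u} {k} wk with L i u | isDepth i u
  ... | fin ℓ | _ = ℓ , refl
  ... | ∞ | unreachable = contradiction wk (unreachable k)

  hasIn : ∀ {i u ℓ} → L i u ≡ fin ℓ → HasIn i u
  hasIn eq with walk eq
  ... | here = inj₁ refl
  ... | step {w} _ e = inj₂ (w , e)

  rootDepth : ∀ i → L i (root i) ≡ fin 0
  rootDepth i with walk-finite {i} here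
  ... | k , eq = trans eq (cong fin (n≤0⇒n≡0 (walk-minimal eq here)))

  -- Any walk to the child of `x` passes through `x`.
  below-parent : ∀ {i x y ℓ k} → Walk i y k → E i x y ≡ true → L i x ≡ fin ℓ → suc ℓ ≤ k
  below-parent {i} {x} here e _ = contradiction e (noLinkIntoRoot i x)
  below-parent {i} {x} {y} (step {w} wk e′) e eqx =
    s≤s (walk-minimal eqx (subst (λ z → Walk i z _) (parentUnique i w x y e′ e) wk))

  childDepth : ∀ {i x y ℓ} → L i x ≡ fin ℓ → E i x y ≡ true → L i y ≡ fin (suc ℓ)
  childDepth eqx e with walk-finite (step (walk eqx) e)
  ... | k , eqy = trans eqy (cong fin (≤-antisym (walk-minimal eqy (step (walk eqx) e))
                                                 (below-parent (walk eqy) e eqx)))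

  parentDepth : ∀ {i w ℓ} → L i w ≡ fin (suc ℓ) → ∃ λ p → E i p w ≡ true × L i p ≡ fin ℓ
  parentDepth eqw with walk eqw
  ... | step {p} wk e with walk-finite wk
  ...   | k , eqp = p , e , trans eqp (cong fin (≤-antisym (walk-minimal eqp wk)
                                          (≤-pred (walk-minimal eqw (step (walk eqp) e)))))

  trivialTree : ∀ j → dcol j (root j) ≡ 0 → ∀ {u k} → Walk j u k → u ≡ root j
  trivialTree j _ here = refl
  trivialTree j none (step {x = x} wk e) with trivialTree j none wk
  ... | refl = contradiction (subst (1 ≤_) none (countB-true (E j (root j)) x e)) (λ ())

module Stable {N M K c : ℕ} (M≤N : M ≤ N) (E : Config M N) (dbar : Fin N → ℕ)
              (L : Fin M → Fin N → ℕ∞)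
              (isDepth : ∀ i u → Model.IsDepth M≤N E i u (L i u))
              (a1 : Model.A1 M≤N E K dbar) (a5 : Model.A5 M≤N E dbar) (c≥1 : 1 ≤ c)
              (a6 : Model.WithDepth.A6 M≤N E L c)
              (noSingle : ∀ u v → ¬ Model.WithDepth.SingleTrue M≤N E L dbar u v)
              (noMix : ∀ u v → ¬ Model.WithDepth.MixSwapTrue M≤N E L u v) where

  open Model M≤N E
  open WithDepth L
  open Depths M≤N E L isDepth (proj₁ (proj₂ a1))

  capacity : ∀ u → d u ≤ dbar u
  capacity = proj₂ (proj₂ a1)

  module _ {i j : Fin M} (i≢j : i ≢ j) where

    Tie : Fin N → Fin N → Set
    Tie u v = (toℕ u < toℕ v × toℕ j < toℕ i) ⊎ (toℕ v < toℕ u × toℕ i < toℕ j)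

    tie-order : ∀ {x y} → x ≢ y → Tie x y ⊎ Tie y x
    tie-order {x} {y} x≢y with <-cmp (toℕ x) (toℕ y) | <-cmp (toℕ j) (toℕ i)
    ... | tri≈ _ x≡y _ | _ = contradiction (FP.toℕ-injective x≡y) x≢y
    ... | _ | tri≈ _ j≡i _ = contradiction (FP.toℕ-injective (sym j≡i)) i≢j
    ... | tri< x<y _ _ | tri< j<i _ _ = inj₁ (inj₁ (x<y , j<i))
    ... | tri< x<y _ _ | tri> _ _ i<j = inj₂ (inj₂ (x<y , i<j))
    ... | tri> _ _ y<x | tri< j<i _ _ = inj₂ (inj₁ (y<x , j<i))
    ... | tri> _ _ y<x | tri> _ _ i<j = inj₁ (inj₂ (y<x , i<j))

    swapBlocked : ∀ u v uc vc → E i u uc ≡ true → E j v vc ≡ true → L i u ≡ L i v →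
      L j u ≤∞ L j v → L j u ≢ L j v ⊎ (L j u ≡ L j v × Tie u v) → ⊥
    swapBlocked u v uc vc euc evc i-level j-below condition =
      noMix uc v (i , j , vc , u , i≢j , evc , euc , ≤∞-reflexive (sym i-level) , j-below , mixCase condition)
      where
      mixCase : L j u ≢ L j v ⊎ (L j u ≡ L j v × Tie u v) →
        (L i u ≢ L i v ⊎ L j u ≢ L j v) ⊎ (L i u ≡ L i v × L j u ≡ L j v × Tie u v)
      mixCase (inj₁ j-differ) = inj₁ (inj₂ j-differ)
      mixCase (inj₂ (j-level , tie)) = inj₂ (i-level , j-level , tie)

    mixUnique : ∀ {ℓ} x y → L i x ≡ fin ℓ → L i y ≡ fin ℓ → 1 ≤ dcol i x → 1 ≤ dcol i y →
      1 ≤ dcol j x → 1 ≤ dcol j y → x ≡ y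
    mixUnique x y lx ly ix iy jx jy with x F.≟ y
    ... | yes x≡y = x≡y
    ... | no x≢y
      with countB-witness _ ix | countB-witness _ iy | countB-witness _ jx | countB-witness _ jy
    ... | xi , exi | yi , eyi | xj , exj | yj , eyj with L j x ≟∞ L j y
    ...   | no j-differ = ⊥-elim (by-order (≤∞-total (L j x) (L j y)))
      where
      by-order : L j x ≤∞ L j y ⊎ L j y ≤∞ L j x → ⊥
      by-order (inj₁ x≤y) = swapBlocked x y xi yj exi eyj (trans lx (sym ly)) x≤y (inj₁ j-differ)
      by-order (inj₂ y≤x) = swapBlocked y x yi xj eyi exj (trans ly (sym lx)) y≤x (inj₁ (j-differ ∘ sym))
    ...   | yes j-same = ⊥-elim (by-tie (tie-order x≢y))
      where
      by-tie : Tie x y ⊎ Tie y x → ⊥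
      by-tie (inj₁ t) = swapBlocked x y xi yj exi eyj (trans lx (sym ly)) (≤∞-reflexive j-same) (inj₂ (j-same , t))
      by-tie (inj₂ t) = swapBlocked y x yi xj eyi exj (trans ly (sym lx)) (≤∞-reflexive (sym j-same)) (inj₂ (sym j-same , t))

  -- By (A6) the j-tree has M ≥ 2 distinct leaves, so root j has a j-child.
  rootHasChild : ∀ {i j} → i ≢ j → dcol j (root j) ≢ 0
  rootHasChild {i} {j} i≢j none with a6 j
  ... | f , f-inj , leaves = i≢j (f-inj (trans (atRoot i) (sym (atRoot j))))
    where
    atRoot : ∀ m → f m ≡ root j
    atRoot m with L j (f m) in eq | proj₁ (leaves m)
    ... | fin _ | _ = trivialTree j none (walk eq)

  module BelowNode (i : Fin M) (w : Fin N) (D : ℕ) (eqw : L i w ≡ fin (suc D)) where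

    parent : ∃ λ p → E i p w ≡ true × L i p ≡ fin D
    parent = parentDepth eqw

    -- No LeafSwap(parent of w, v): nodes above depth D have an i-child.
    internal : ∀ {v ℓ} → L i v ≡ fin ℓ → ℓ < D → 1 ≤ dcol i v
    internal {v} eqv ℓ<D with parent | dcol i v ≟ 0
    ... | _ | no ≢0 = n≢0⇒n>0 ≢0
    ... | p , epw , eqp | yes ≡0 = contradiction
          (i , hasIn eqp , hasIn eqv ,
           inj₂ (≡0 , countB-true _ w epw , subst₂ _<∞_ (sym eqv) (sym eqp) ℓ<D))
          (noSingle p v)

    -- No Jump(w, v): nodes above depth D have no spare capacity.
    saturated : ∀ {v ℓ} → L i v ≡ fin ℓ → ℓ < D → dbar v ≤ d v
    saturated {v} eqv ℓ<D with d v <? dbar v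
    ... | no d≮dbar = ≮⇒≥ d≮dbar
    ... | yes d<dbar = contradiction
          (i , hasIn eqw , hasIn eqv ,
           inj₁ (d<dbar , subst₂ (λ a b → suc∞ a <∞ b) (sym eqv) (sym eqw) (s≤s ℓ<D)))
          (noSingle w v)

    -- Between depths c and D, a node with a single i-child also has a child of
    -- another colour: otherwise its capacity would be 1, forbidden by (A5).
    secondColour : ∀ {x ℓ} → L i x ≡ fin ℓ → c ≤ ℓ → ℓ < D → dcol i x ≡ 1 →
      ∃ λ j → j ≢ i × 1 ≤ dcol j x
    secondColour {x} {ℓ} eqx c≤ℓ ℓ<D single with 1 <? d x
    ... | yes 1<d = sumF-exceeds (λ j → dcol j x) i (subst (_< d x) (sym single) 1<d)
    ... | no 1≮d = contradiction (≤-antisym (≤-trans (saturated eqx ℓ<D) d≤1)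
                                            (≤-trans d≥1 (capacity x)))
                                 (a5 x notRoot)
      where
      d≥1 : 1 ≤ d x
      d≥1 = subst (_≤ d x) single (sumF-single (λ j → dcol j x) i)
      d≤1 : d x ≤ 1
      d≤1 = ≮⇒≥ 1≮d
      notRoot : ¬ IsRoot x
      notRoot (j , x≡root) with j F.≟ i
      ... | yes refl = contradiction
            (subst (c ≤_) (fin-injective (trans (sym eqx) (trans (cong (L i) x≡root) (rootDepth i)))) c≤ℓ)
            (λ c≤0 → 1+n≰n (≤-trans c≥1 c≤0))
      ... | no j≢i = rootHasChild (j≢i ∘ sym) (subst (λ z → dcol j z ≡ 0) x≡root no-j-child)
        where
        no-j-child : dcol j x ≡ 0
        no-j-child = n≤0⇒n≡0 (+-cancelˡ-≤ 1 _ 0 (subst (λ a → a + dcol j x ≤ 1) single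
                       (≤-trans (sumF-two (λ k → dcol k x) i j (j≢i ∘ sym)) d≤1)))

    hatLeafDepth : c ≤ D → ∀ {x} → HatLeaf c i x → L i x ≡ fin c
    hatLeafDepth c≤D {x} (inHat , noChild) with L i x in eqx | inHat
    ... | fin k | k≤c with m≤n⇒m<n∨m≡n k≤c
    ...   | inj₂ k≡c = cong fin k≡c
    ...   | inj₁ k<c with countB-witness (E i x) (internal eqx (<-≤-trans k<c c≤D))
    ...     | y , e = contradiction (subst (_≤∞ fin c) (sym (childDepth eqx e)) k<c) (noChild y e)

    size : ℕ → ℕ
    size ℓ = countB (atLevel (L i) ℓ)

    others : ℕ
    others = countB (λ j → does (¬? (j F.≟ i)))

    -- (A6): the M distinct hat-leaves sit at depth c.
    size-start : c ≤ D → suc others ≤ size c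
    size-start c≤D with a6 i
    ... | f , f-inj , leaves = subst (_≤ size c) (trans countB-all (sym (count-others i)))
      (count-injection (λ _ → true) (atLevel (L i) c) (λ m x → does (f m F.≟ x))
        (λ m _ → f m , dec-true (f m F.≟ f m) refl)
        (λ m x e → dec-true (L i x ≟∞ fin c)
          (subst (λ z → L i z ≡ fin c) (does-sound (f m F.≟ x) e) (hatLeafDepth c≤D (leaves m))))
        (λ m m′ x e e′ → f-inj (trans (does-sound (f m F.≟ x) e) (sym (does-sound (f m′ F.≟ x) e′)))))

    link : ℕ → Fin N → Fin N → Bool
    link ℓ x y = atLevel (L i) ℓ x ∧ E i x y

    -- Each such link enters a distinct node of depth ℓ + 1.
    links-count : ∀ ℓ → sumF (λ x → countB (link ℓ x)) ≤ size (suc ℓ)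
    links-count ℓ = count-relation (link ℓ) (atLevel (L i) (suc ℓ)) enters unique-parent
      where
      from-level : ∀ {x y} → link ℓ x y ≡ true → L i x ≡ fin ℓ × E i x y ≡ true
      from-level {x} {y} e with L i x ≟∞ fin ℓ | E i x y
      ... | yes eqx | true = eqx , refl
      enters : ∀ x y → link ℓ x y ≡ true → atLevel (L i) (suc ℓ) y ≡ true
      enters x y e with from-level e
      ... | eqx , exy = dec-true (L i y ≟∞ _) (childDepth eqx exy)
      unique-parent : ∀ x x′ y → link ℓ x y ≡ true → link ℓ x′ y ≡ true → x ≡ x′
      unique-parent x x′ y e e′ = parentUnique i x x′ y (proj₂ (from-level e)) (proj₂ (from-level e′))

    lone? : (ℓ : ℕ) (x : Fin N) → Dec (L i x ≡ fin ℓ × dcol i x ≡ 1)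
    lone? ℓ x = (L i x ≟∞ fin ℓ) ×-dec (dcol i x ≟ 1)

    -- Each of them owns a colour j ≢ i, and distinct ones own distinct colours (mixUnique).
    lone-count : ∀ ℓ → c ≤ ℓ → ℓ < D → countB (does ∘ lone? ℓ) ≤ others
    lone-count ℓ c≤ℓ ℓ<D =
      count-injection (does ∘ lone? ℓ) (λ j → does (¬? (j F.≟ i))) owns has-owner other distinct
      where
      owns? : (x : Fin N) (j : Fin M) → Dec (j ≢ i × (L i x ≡ fin ℓ × dcol i x ≡ 1) × 1 ≤ dcol j x)
      owns? x j = ¬? (j F.≟ i) ×-dec lone? ℓ x ×-dec (1 ≤? dcol j x)
      owns : Fin N → Fin M → Bool
      owns x j = does (owns? x j)
      has-owner : ∀ x → does (lone? ℓ x) ≡ true → ∃ λ j → owns x j ≡ true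
      has-owner x e with does-sound (lone? ℓ x) e
      ... | eqx , single with secondColour eqx c≤ℓ ℓ<D single
      ...   | j , j≢i , jx = j , dec-true (owns? x j) (j≢i , (eqx , single) , jx)
      other : ∀ x j → owns x j ≡ true → does (¬? (j F.≟ i)) ≡ true
      other x j e = dec-true (¬? (j F.≟ i)) (proj₁ (does-sound (owns? x j) e))
      distinct : ∀ x x′ j → owns x j ≡ true → owns x′ j ≡ true → x ≡ x′
      distinct x x′ j e e′ with does-sound (owns? x j) e | does-sound (owns? x′ j) e′
      ... | j≢i , (eqx , sx) , jx | _ , (eqx′ , sx′) , jx′ =
        mixUnique (j≢i ∘ sym) x x′ eqx eqx′ (≤-reflexive (sym sx)) (≤-reflexive (sym sx′)) jx jx′

    -- Every node of depth ℓ < D has two i-children, or one and is counted as lone.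
    node-bound : ∀ ℓ → ℓ < D → ∀ x →
      ind (atLevel (L i) ℓ x) + ind (atLevel (L i) ℓ x) ≤ countB (link ℓ x) + ind (does (lone? ℓ x))
    node-bound ℓ ℓ<D x with L i x ≟∞ fin ℓ
    ... | no _ = z≤n
    ... | yes eqx with dcol i x | internal eqx ℓ<D
    ...   | suc zero | _ = ≤-refl
    ...   | suc (suc _) | _ = s≤s (s≤s z≤n)

    recurrence : ∀ ℓ → c ≤ ℓ → ℓ < D → 2 * size ℓ ≤ size (suc ℓ) + others
    recurrence ℓ c≤ℓ ℓ<D = begin
      2 * size ℓ                                              ≡⟨ cong (size ℓ +_) (+-identityʳ (size ℓ)) ⟩
      size ℓ + size ℓ                                         ≡⟨ cong₂ _+_ (countB-sum (atLevel (L i) ℓ)) (countB-sum (atLevel (L i) ℓ)) ⟩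
      sumF (ind ∘ atLevel (L i) ℓ) + sumF (ind ∘ atLevel (L i) ℓ) ≡⟨ sumF-+ (ind ∘ atLevel (L i) ℓ) (ind ∘ atLevel (L i) ℓ) ⟨
      sumF (λ x → ind (atLevel (L i) ℓ x) + ind (atLevel (L i) ℓ x)) ≤⟨ sumF-mono (node-bound ℓ ℓ<D) ⟩
      sumF (λ x → countB (link ℓ x) + ind (does (lone? ℓ x)))  ≡⟨ sumF-+ (countB ∘ link ℓ) (ind ∘ does ∘ lone? ℓ) ⟩
      sumF (countB ∘ link ℓ) + sumF (ind ∘ does ∘ lone? ℓ)    ≡⟨ cong (sumF (countB ∘ link ℓ) +_) (countB-sum (does ∘ lone? ℓ)) ⟨
      sumF (countB ∘ link ℓ) + countB (does ∘ lone? ℓ)         ≤⟨ +-mono-≤ (links-count ℓ) (lone-count ℓ c≤ℓ ℓ<D) ⟩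
      size (suc ℓ) + others                                   ∎
      where open ≤-Reasoning

lemma4 : (N M K c : ℕ) (M≤N : M ≤ N) → 1 ≤ K → K ≤ M →
    (E : Config M N) (dbar : Fin N → ℕ) (L : Fin M → Fin N → ℕ∞) →
    (∀ i u → Model.IsDepth M≤N E i u (L i u)) →
    Model.A1 M≤N E K dbar →
    Model.A5 M≤N E dbar →
    1 ≤ c → Model.WithDepth.A6 M≤N E L c →
    (∀ u v → ¬ Model.WithDepth.SingleTrue M≤N E L dbar u v) →
    (∀ u v → ¬ Model.WithDepth.MixSwapTrue M≤N E L u v) →
    ∀ i w k → L i w ≡ fin k → 2 ^ (k ∸ c) ≤ suc N
lemma4 N M K c M≤N _ _ E dbar L isDepth a1 a5 c≥1 a6 noSingle noMix i w k eqw with k ≤? c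
... | yes k≤c = subst (λ e → 2 ^ e ≤ suc N) (sym (m≤n⇒m∸n≡0 k≤c)) (s≤s z≤n)
... | no k≰c with ≰⇒> k≰c
... | s≤s {n = D} c≤D = begin
  2 ^ (suc D ∸ c)                             ≡⟨ cong (2 ^_) (+-∸-assoc 1 c≤D) ⟩
  2 ^ suc T                                   ≤⟨ total-growth T ≤-refl ⟩
  suc (sumBelow (λ t → size (c + t)) (suc T)) ≤⟨ s≤s (levels-disjoint (L i) c (suc T)) ⟩
  suc N                                       ∎
  where
  open ≤-Reasoning
  open Stable M≤N E dbar L isDepth a1 a5 c≥1 a6 noSingle noMix
  open BelowNode i w D eqw
  -- the depths c, c + 1, …, c + T = D
  T : ℕ
  T = D ∸ c
  c+t<D : ∀ {t} → t < T → c + t < D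
  c+t<D t<T = subst (_ <_) (m+[n∸m]≡n c≤D) (+-monoʳ-< c t<T)
  open Doubling (λ t → size (c + t)) others T
    (subst (λ e → suc others ≤ size e) (sym (+-identityʳ c)) (size-start c≤D))
    (λ t t<T → subst (λ e → 2 * size (c + t) ≤ size e + others) (sym (+-suc c t))
                 (recurrence (c + t) (m≤m+n c t) (c+t<D t<T)))
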